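{- Let $n\ge1$ and let $\underline{a}$ and $\underline{b}$ be distinct arc-connected words of the list $G_n$ such that every word listed strictly between them in $G_n$ is arc-disconnected. Then $\pi(\underline{a})$ and $\pi(\underline{b})$ differ by an adjacent transposition. Consequently, deleting from the list $(\pi(\underline{a}))_{\underline{a}\in G_n}$ all sign-disconnected permutations yields an adjacent transposition Gray code for the sign-connected standard permutations of $\{\pm1,\ldots,\pm n\}$ (which encode the shelling types of the boundary of the $n$-cube).
   Context: A standard permutation of $\{\pm1,\ldots,\pm n\}$ is a word in which each element appears exactly once, $i$ occurs before $-i$ for each $i$, and the negative entries occur in the order $-1,\ldots,-n$. For a word $a_1\cdots a_n$ with $1\le a_i\le 2i-1$, $\pi(a_1\cdots a_n)$ is defined recursively: $\pi(a_1)=(1,-1)$, and for $n\ge2$, $\pi(a_1\cdots a_n)$ is obtained from $\pi(a_1\cdots a_{n-1})$ (length $2n-2$) by inserting $n$ so that it occupies position $a_n$ and then appending $-n$ at the end. The list $G_n$ of such words is defined recursively: $G_1=(1)$; for $n\ge2$, if $G_{n-1}=(w_1,\ldots,w_N)$, then $G_n$ is the concatenation over $m=1,\ldots,N$ of the blocks $(w_m1,\ldots,w_m(2n-1))$ for $m$ odd and $(w_m(2n-1),\ldots,w_m1)$ for $m$ even, where $w_mx$ denotes $w_m$ with the letter $x$ appended. A permutation $\pi$ of $\{\pm1,\ldots,\pm n\}$ is sign-connected if for every $1\le m<2n$ there is $j$ with $|\{\pi(1),\ldots,\pi(m)\}\cap\{ -j,j\}|=1$, otherwise sign-disconnected. A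 word $\underline{a}$ is arc-connected if $\pi(\underline{a})$ is sign-connected, arc-disconnected otherwise. Two words of length $2n$ differ by an adjacent transposition if one is obtained from the other by exchanging the entries in two consecutive positions. -}

module Defs where

open import Data.Nat using (ℕ; zero; suc; _∸_; _*_; _<_; _≤_)
open import Data.Integer using (ℤ; +_; -_; -[1+_])
open import Data.List using (List; []; _∷_; _++_; [_]; map; upTo; reverse; take; length; concatMap)
open import Data.List.Membership.Propositional using (_∈_)
open import Data.List.Relation.Binary.Permutation.Propositional using (_↭_)
open import Data.Bool using (Bool; true; false; not)
open import Data.Product using (∃; _×_; _,_)
open import Data.Sum using (_⊎_)
open import Relation.Nullary using (¬_)
open import Relation.Binary.PropositionalEquality using (_≡_)

range : ℕ → List ℕ
range k = map suc (upTo k)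

-- insert x so that it occupies position (k+1) (1-indexed), i.e. index k (0-indexed)
insertAt : {A : Set} → ℕ → A → List A → List A
insertAt zero    x xs       = x ∷ xs
insertAt (suc k) x []       = x ∷ []
insertAt (suc k) x (y ∷ ys) = y ∷ insertAt k x ys

-- π(a₁⋯aₙ), processing the word left to right; k = number of letters processed so far
πAux : ℕ → List ℤ → List ℕ → List ℤ
πAux k acc []       = acc
πAux k acc (a ∷ as) =
  πAux (suc k) (insertAt (a ∸ 1) (+ suc k) acc ++ [ - (+ suc k) ]) as

π : List ℕ → List ℤ
π w = πAux 0 [] w

-- blocks of G_{n+1}: for the m-th word w_m of G_n (parity flag = m odd),
-- the words w_m 1, …, w_m (2(n+1)-1) (reversed when m even)
blocks : Bool → ℕ → List (List ℕ) → List (List ℕ)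
blocks odd k []       = []
blocks true  k (w ∷ ws) = map (λ x → w ++ [ x ]) (range k) ++ blocks false k ws
blocks false k (w ∷ ws) = map (λ x → w ++ [ x ]) (reverse (range k)) ++ blocks true k ws

G : ℕ → List (List ℕ)
G zero    = [] ∷ []
G (suc n) = blocks true (2 * suc n ∸ 1) (G n)

OneOf : ℕ → List ℤ → Set
OneOf j xs = ((+ j) ∈ xs × ¬ (- (+ j)) ∈ xs) ⊎ (¬ (+ j) ∈ xs × (- (+ j)) ∈ xs)

SignConnected : List ℤ → Set
SignConnected p = ∀ m → 1 ≤ m → m < length p → ∃ λ j → OneOf j (take m p)

ArcConnected : List ℕ → Set
ArcConnected w = SignConnected (π w)

AdjTransp : List ℤ → List ℤ → Set
AdjTransp p q = ∃ λ xs → ∃ λ ys → ∃ λ x → ∃ λ y →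
  (p ≡ xs ++ x ∷ y ∷ ys) × (q ≡ xs ++ y ∷ x ∷ ys)

signedList : ℕ → List ℤ
signedList n = concatMap (λ i → (+ i) ∷ (- (+ i)) ∷ []) (range n)

negs : List ℤ → List ℤ
negs []              = []
negs (+ k ∷ xs)      = negs xs
negs (-[1+ k ] ∷ xs) = -[1+ k ] ∷ negs xs

StandardPerm : ℕ → List ℤ → Set
StandardPerm n p =
  (p ↭ signedList n) ×
  (∀ i → i ∈ range n → ∃ λ xs → ∃ λ ys → (p ≡ xs ++ (+ i) ∷ ys) × (- (+ i)) ∈ ys) ×
  (negs p ≡ map (λ i → - (+ i)) (range n))

module Submission where

-- Appending the letter j+1 to a word w of length n turns q = π w into
-- "step n q (j+1)": n+1 is inserted at index j and -(n+1) appended.  This is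
-- sign-connected iff the prefixes of q of length ≤ j are unbalanced (contain
-- exactly one of ±i for some i).  So inside a block of G (n+1) the connected
-- words form an initial segment of insertion indices, and neighbours differ
-- by moving n+1 one place.  Across blocks we carry the invariant that
-- consecutive words of G n differ by a swap, every other one "strong"
-- (unbalanced prefixes around the pair, supplied by a parity lemma); a strong
-- swap forces the two maximal connected indices to agree, giving adjacency
-- at the junction.

open import Defs
open import Data.Nat using (ℕ; zero; suc; _+_; _∸_; _*_; _<_; _≤_; z≤n; s≤s; _≤?_; _≟_)
open import Data.Nat.Properties
open import Data.Fin using (Fin; toℕ) renaming (zero to fzero; suc to fsuc)
open import Data.Integer using (ℤ; +_; -_; -[1+_])
import Data.Integer as ℤ
open import Data.Integer.Properties using (neg-involutive; neg-injective)
open import Data.Bool using (Bool; true; false; not)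
open import Data.Bool.Properties using (not-involutive)
open import Data.List using (List; []; _∷_; _∷ʳ′_; initLast; _++_; [_]; map; upTo; reverse; take; length; concatMap; lookup; applyUpTo; applyDownFrom)
open import Data.List.Properties using (∷-injective; ∷-injectiveʳ; ∷ʳ-injectiveˡ; ∷ʳ-injectiveʳ; map-upTo; map-applyUpTo; reverse-map; reverse-applyUpTo; map-++; ++-assoc; ++-identityʳ; length-++; length-++-sucʳ; concatMap-++; upTo-∷ʳ)
open import Data.List.Membership.Propositional using (_∈_; _∉_)
open import Data.List.Membership.Propositional.Properties using (∈-++⁺ˡ; ∈-++⁺ʳ; ∈-++⁻; ∈-∃++; ∈-map⁺; ∈-map⁻; ∈-upTo⁺; ∈-upTo⁻; ∈-lookup)
open import Data.List.Membership.DecPropositional ℤ._≟_ using (_∈?_)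
open import Data.List.Relation.Unary.All using (All; []; _∷_)
import Data.List.Relation.Unary.All as All
open import Data.List.Relation.Unary.Unique.Propositional using (Unique; []; _∷_)
import Data.List.Relation.Unary.Unique.Propositional.Properties as Unique
import Data.List.Relation.Binary.Permutation.Setoid.Properties as PermutationSetoid
import Data.List.Membership.Setoid.Properties as SetoidMembership
open import Data.List.Relation.Unary.Any using (here; there; index)
open import Data.List.Relation.Unary.Any.Properties using (lookup-index)
open import Data.List.Relation.Binary.Permutation.Propositional using (_↭_; prep; swap; ↭-refl; ↭-trans; ↭-sym; ↭⇒↭ₛ)
open import Data.List.Relation.Binary.Permutation.Propositional.Properties using (++⁺ˡ; ++⁺ʳ; shift; ∈-resp-↭; ↭-length; ++-comm; drop-∷; ↭-empty-inv)
open import Data.Product using (∃; _×_; _,_; proj₁; proj₂)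
open import Data.Sum using (_⊎_; inj₁; inj₂)
open import Data.Empty using (⊥-elim)
open import Data.Unit using (⊤; tt)
open import Relation.Nullary using (¬_; yes; no)
open import Relation.Binary.Definitions using (tri<; tri≈; tri>)
open import Relation.Binary.PropositionalEquality hiding ([_])

range-suc : ∀ n → range (suc n) ≡ range n ++ [ suc n ]
range-suc n = trans (cong (map suc) (sym (upTo-∷ʳ n))) (map-++ suc (upTo n) [ n ])

signedList-suc : ∀ n → signedList (suc n) ≡ signedList n ++ + suc n ∷ -[1+ n ] ∷ []
signedList-suc n = begin
  concatMap pair (range (suc n))              ≡⟨ cong (concatMap pair) (range-suc n) ⟩
  concatMap pair (range n ++ [ suc n ])       ≡⟨ concatMap-++ pair (range n) [ suc n ] ⟩
  signedList n ++ pair (suc n) ++ []          ≡⟨ cong (signedList n ++_) (++-identityʳ _) ⟩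
  signedList n ++ + suc n ∷ -[1+ n ] ∷ []     ∎
  where
  open ≡-Reasoning
  pair : ℕ → List ℤ
  pair i = + i ∷ - (+ i) ∷ []

module _ {A : Set} where

  insertAt-↭ : ∀ j (z : A) l → insertAt j z l ↭ z ∷ l
  insertAt-↭ zero    z l       = ↭-refl
  insertAt-↭ (suc j) z []      = ↭-refl
  insertAt-↭ (suc j) z (y ∷ l) = ↭-trans (prep y (insertAt-↭ j z l)) (swap y z ↭-refl)

  length-insertAt : ∀ j (z : A) l → length (insertAt j z l) ≡ suc (length l)
  length-insertAt zero    z l       = refl
  length-insertAt (suc j) z []      = refl
  length-insertAt (suc j) z (y ∷ l) = cong suc (length-insertAt j z l)

  ∈-insertAt⁺ : ∀ {t} j (z : A) l → t ∈ l → t ∈ insertAt j z l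
  ∈-insertAt⁺ zero    z l       t∈         = there t∈
  ∈-insertAt⁺ (suc j) z (y ∷ l) (here t≡y) = here t≡y
  ∈-insertAt⁺ (suc j) z (y ∷ l) (there t∈) = there (∈-insertAt⁺ j z l t∈)

  ∈-insertAt⁻ : ∀ {t} j (z : A) l → t ∈ insertAt j z l → t ≡ z ⊎ t ∈ l
  ∈-insertAt⁻ zero    z l       (here t≡z) = inj₁ t≡z
  ∈-insertAt⁻ zero    z l       (there t∈) = inj₂ t∈
  ∈-insertAt⁻ (suc j) z []      (here t≡z) = inj₁ t≡z
  ∈-insertAt⁻ (suc j) z (y ∷ l) (here t≡y) = inj₂ (here t≡y)
  ∈-insertAt⁻ (suc j) z (y ∷ l) (there t∈) with ∈-insertAt⁻ j z l t∈
  ... | inj₁ t≡z = inj₁ t≡z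
  ... | inj₂ t∈l = inj₂ (there t∈l)

  insertAt-++ : ∀ j (z : A) xs r → j ≤ length xs → insertAt j z (xs ++ r) ≡ insertAt j z xs ++ r
  insertAt-++ zero    z xs       r _         = refl
  insertAt-++ (suc j) z (x ∷ xs) r (s≤s j≤) = cong (x ∷_) (insertAt-++ j z xs r j≤)

  insertAt-shift : ∀ (z : A) xs r d → insertAt (length xs + d) z (xs ++ r) ≡ xs ++ insertAt d z r
  insertAt-shift z []       r d = refl
  insertAt-shift z (x ∷ xs) r d = cong (x ∷_) (insertAt-shift z xs r d)

  insertAt-after : ∀ (z : A) xs r → insertAt (length xs) z (xs ++ r) ≡ xs ++ z ∷ r
  insertAt-after z []       r = refl
  insertAt-after z (x ∷ xs) r = cong (x ∷_) (insertAt-after z xs r)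

  insertAt-end : ∀ (z : A) l → insertAt (length l) z l ≡ l ++ [ z ]
  insertAt-end z []      = refl
  insertAt-end z (x ∷ l) = cong (x ∷_) (insertAt-end z l)

  -- An element absent from l and l′ marks where it was inserted.
  insertAt-injective : ∀ j j′ (z : A) l l′ → z ∉ l → z ∉ l′ → j ≤ length l → j′ ≤ length l′ →
    insertAt j z l ≡ insertAt j′ z l′ → j ≡ j′ × l ≡ l′
  insertAt-injective zero    zero     z l       l′        _   _    _         _          eq = refl , ∷-injectiveʳ eq
  insertAt-injective zero    (suc j′) z l       (y′ ∷ l′) _   z∉l′ _         _          eq = ⊥-elim (z∉l′ (here (proj₁ (∷-injective eq))))
  insertAt-injective (suc j) zero     z (y ∷ l) l′        z∉l _    _         _          eq = ⊥-elim (z∉l (here (sym (proj₁ (∷-injective eq)))))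
  insertAt-injective (suc j) (suc j′) z (y ∷ l) (y′ ∷ l′) z∉l z∉l′ (s≤s j≤) (s≤s j′≤) eq
    with refl , eq′ ← ∷-injective eq
    with refl , refl ← insertAt-injective j j′ z l l′ (λ z∈ → z∉l (there z∈)) (λ z∈ → z∉l′ (there z∈)) j≤ j′≤ eq′
    = refl , refl

  take-insertAt : ∀ (z : A) t j l r → t ≤ j → t ≤ length l → take t (insertAt j z l ++ r) ≡ take t l
  take-insertAt z zero    j       l       r _         _         = refl
  take-insertAt z (suc t) (suc j) (y ∷ l) r (s≤s t≤j) (s≤s t≤l) = cong (y ∷_) (take-insertAt z t j l r t≤j t≤l)

  ∈-take-insertAt : ∀ (z : A) t j l r → j < t → z ∈ take t (insertAt j z l ++ r)
  ∈-take-insertAt z (suc t) zero    l       r _         = here refl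
  ∈-take-insertAt z (suc t) (suc j) []      r _         = here refl
  ∈-take-insertAt z (suc t) (suc j) (y ∷ l) r (s≤s j<t) = there (∈-take-insertAt z t j l r j<t)

  take-++ : ∀ t (l r : List A) → t ≤ length l → take t (l ++ r) ≡ take t l
  take-++ zero    l       r _        = refl
  take-++ (suc t) (y ∷ l) r (s≤s t≤) = cong (y ∷_) (take-++ t l r t≤)

  ∈-take : ∀ {a} t (l : List A) → a ∈ take t l → a ∈ l
  ∈-take (suc t) (y ∷ l) (here a≡y) = here a≡y
  ∈-take (suc t) (y ∷ l) (there a∈) = there (∈-take t l a∈)

  take-+-length : ∀ (xs : List A) k r → take (k + length xs) (xs ++ r) ≡ xs ++ take k r
  take-+-length []       k r = cong (λ t → take t r) (+-identityʳ k)
  take-+-length (x ∷ xs) k r =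
    trans (cong (λ t → take t (x ∷ xs ++ r)) (+-suc k (length xs))) (cong (x ∷_) (take-+-length xs k r))

  split-at : ∀ j (q : List A) → j < length q →
    ∃ λ pre → ∃ λ a → ∃ λ post → (q ≡ pre ++ a ∷ post) × length pre ≡ j
  split-at zero    (a ∷ q) _         = [] , a , q , refl , refl
  split-at (suc j) (b ∷ q) (s≤s j<q) with split-at j q j<q
  ... | pre , a , post , refl , refl = b ∷ pre , a , post , refl , refl

  pair-inside : ∀ {a b : A} xs ys → suc (length xs) < length (xs ++ a ∷ b ∷ ys)
  pair-inside []       ys = s≤s (s≤s z≤n)
  pair-inside (x ∷ xs) ys = s≤s (pair-inside xs ys)

  length-swap : ∀ {a b : A} xs ys → length (xs ++ a ∷ b ∷ ys) ≡ length (xs ++ b ∷ a ∷ ys)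
  length-swap xs ys = trans (length-++ xs) (sym (length-++ xs))

  length-pair : ∀ (a b : A) r₁ r₂ → length (a ∷ r₁ ++ b ∷ r₂) ≡ suc (suc (length (r₁ ++ r₂)))
  length-pair a b r₁ r₂ = cong suc (length-++-sucʳ r₁ b r₂)

  ∈-delete : ∀ (r₁ : List A) {b r₂ t} → t ∈ r₁ ++ r₂ → t ∈ r₁ ++ b ∷ r₂
  ∈-delete r₁ t∈ with ∈-++⁻ r₁ t∈
  ... | inj₁ t∈r₁ = ∈-++⁺ˡ t∈r₁
  ... | inj₂ t∈r₂ = ∈-++⁺ʳ r₁ (there t∈r₂)

  Unique-↭ : ∀ {xs ys : List A} → xs ↭ ys → Unique xs → Unique ys
  Unique-↭ xs↭ys = PermutationSetoid.Unique-resp-↭ (setoid A) (↭⇒↭ₛ xs↭ys)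

  Unique-shift : ∀ (r₁ : List A) {b r₂} → Unique (r₁ ++ b ∷ r₂) → Unique (b ∷ r₁ ++ r₂)
  Unique-shift r₁ {b} {r₂} = Unique-↭ (shift b r₁ r₂)

  Unique-deletePair : ∀ {a b : A} r₁ {r₂} → Unique (a ∷ r₁ ++ b ∷ r₂) → Unique (r₁ ++ r₂)
  Unique-deletePair r₁ u = Unique.drop⁺ 1 (Unique-shift r₁ (Unique.drop⁺ 1 u))

  nothing-after-last : ∀ as {x : A} {bs} init → Unique (init ++ [ x ]) → as ++ x ∷ bs ≡ init ++ [ x ] → bs ≡ []
  nothing-after-last []          []         _ eq = ∷-injectiveʳ eq
  nothing-after-last []          (y ∷ init) u eq with refl , _ ← ∷-injective eq =
    ⊥-elim (Unique.Unique[x∷xs]⇒x∉xs u (∈-++⁺ʳ init (here refl)))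
  nothing-after-last (a ∷ [])    []         _ ()
  nothing-after-last (a ∷ _ ∷ _) []         _ ()
  nothing-after-last (a ∷ as)    (y ∷ init) u eq = nothing-after-last as init (Unique.drop⁺ 1 u) (∷-injectiveʳ eq)

  lookup-injective : ∀ {L : List A} → Unique L → ∀ i k → lookup L i ≡ lookup L k → i ≡ k
  lookup-injective {L = a ∷ L} u        fzero    fzero    _  = refl
  lookup-injective {L = a ∷ L} (a∉ ∷ u) fzero    (fsuc k) eq = ⊥-elim (All.lookup a∉ (∈-lookup k) eq)
  lookup-injective {L = a ∷ L} (a∉ ∷ u) (fsuc i) fzero    eq = ⊥-elim (All.lookup a∉ (∈-lookup i) (sym eq))
  lookup-injective {L = a ∷ L} (a∉ ∷ u) (fsuc i) (fsuc k) eq = cong fsuc (lookup-injective u i k eq)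

-- Appending the letter x to a word of length m acts on its permutation by
-- step m: insert m+1 at position x and append -(m+1).
step : ℕ → List ℤ → ℕ → List ℤ
step m q x = insertAt (x ∸ 1) (+ suc m) q ++ [ -[1+ m ] ]

πAux-++ : ∀ as bs k acc → πAux k acc (as ++ bs) ≡ πAux (length as + k) (πAux k acc as) bs
πAux-++ []       bs k acc = refl
πAux-++ (a ∷ as) bs k acc =
  trans (πAux-++ as bs (suc k) (step k acc a))
        (cong (λ i → πAux i (πAux (suc k) (step k acc a) as) bs) (+-suc (length as) k))

π-snoc : ∀ w x → π (w ++ [ x ]) ≡ step (length w) (π w) x
π-snoc w x = trans (πAux-++ w [ x ] 0 []) (cong (λ i → step i (π w) x) (+-identityʳ (length w)))

-- Before y t l: y occurs in l and t occurs somewhere after it.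
-- This is the inductive form of the second condition of StandardPerm.
data Before (y t : ℤ) : List ℤ → Set where
  here  : ∀ {l} → t ∈ l → Before y t (y ∷ l)
  there : ∀ {a l} → Before y t l → Before y t (a ∷ l)

Before⇒split : ∀ {y t l} → Before y t l → ∃ λ xs → ∃ λ ys → (l ≡ xs ++ y ∷ ys) × t ∈ ys
Before⇒split (here {l} t∈) = [] , l , refl , t∈
Before⇒split (there {a} b) with Before⇒split b
... | xs , ys , refl , t∈ = a ∷ xs , ys , refl , t∈

split⇒Before : ∀ {y t} xs ys → t ∈ ys → Before y t (xs ++ y ∷ ys)
split⇒Before []       ys t∈ = here t∈
split⇒Before (x ∷ xs) ys t∈ = there (split⇒Before xs ys t∈)

Before-insertAt : ∀ {y t} j z l → Before y t l → Before y t (insertAt j z l)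
Before-insertAt zero    z l       b          = there b
Before-insertAt (suc j) z (y ∷ l) (here t∈)  = here (∈-insertAt⁺ j z l t∈)
Before-insertAt (suc j) z (a ∷ l) (there b)  = there (Before-insertAt j z l b)

Before-++ : ∀ {y t l} r → Before y t l → Before y t (l ++ r)
Before-++ r (here t∈) = here (∈-++⁺ˡ t∈)
Before-++ r (there b) = there (Before-++ r b)

Before-step : ∀ j z t l → Before z t (insertAt j z l ++ [ t ])
Before-step zero    z t l       = here (∈-++⁺ʳ l (here refl))
Before-step (suc j) z t []      = here (here refl)
Before-step (suc j) z t (y ∷ l) = there (Before-step j z t l)

negs-++ : ∀ a b → negs (a ++ b) ≡ negs a ++ negs b
negs-++ []              b = refl
negs-++ (+ k ∷ a)       b = negs-++ a b
negs-++ (-[1+ k ] ∷ a)  b = cong (-[1+ k ] ∷_) (negs-++ a b)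

negs-insertAt : ∀ j k l → negs (insertAt j (+ k) l) ≡ negs l
negs-insertAt zero    k l               = refl
negs-insertAt (suc j) k []              = refl
negs-insertAt (suc j) k (+ x ∷ l)       = negs-insertAt j k l
negs-insertAt (suc j) k (-[1+ x ] ∷ l)  = cong (-[1+ x ] ∷_) (negs-insertAt j k l)

∈-range-suc : ∀ {i} n → i ∈ range (suc n) → i ∈ range n ⊎ i ≡ suc n
∈-range-suc {i} n i∈ with ∈-++⁻ (range n) (subst (i ∈_) (range-suc n) i∈)
... | inj₁ i∈n       = inj₁ i∈n
... | inj₂ (here i≡) = inj₂ i≡

negatives : ℕ → List ℤ
negatives n = map (λ i → - (+ i)) (range n)

negatives-suc : ∀ n → negatives (suc n) ≡ negatives n ++ [ -[1+ n ] ]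
negatives-suc n = trans (cong (map (λ i → - (+ i))) (range-suc n)) (map-++ (λ i → - (+ i)) (range n) [ suc n ])

StandardPerm-step : ∀ k q x → StandardPerm k q → StandardPerm (suc k) (step k q x)
StandardPerm-step k q x (perm , order , negs≡) = perm′ , order′ , negs′
  where
  z : ℤ
  z = + suc k
  q′ : List ℤ
  q′ = insertAt (x ∸ 1) z q
  perm′ : q′ ++ [ -[1+ k ] ] ↭ signedList (suc k)
  perm′ = subst (q′ ++ [ -[1+ k ] ] ↭_) (sym (signedList-suc k))
    (↭-trans (++⁺ʳ [ -[1+ k ] ] (insertAt-↭ (x ∸ 1) z q))
    (↭-trans (↭-sym (shift z q [ -[1+ k ] ])) (++⁺ʳ (z ∷ -[1+ k ] ∷ []) perm)))
  order′ : ∀ i → i ∈ range (suc k) → ∃ λ xs → ∃ λ ys → (q′ ++ [ -[1+ k ] ] ≡ xs ++ (+ i) ∷ ys) × (- (+ i)) ∈ ys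
  order′ i i∈ with ∈-range-suc k i∈
  ... | inj₂ refl = Before⇒split (Before-step (x ∸ 1) z -[1+ k ] q)
  ... | inj₁ i∈k with order i i∈k
  ...   | xs , ys , refl , t∈ =
    Before⇒split (Before-++ [ -[1+ k ] ] (Before-insertAt (x ∸ 1) z (xs ++ (+ i) ∷ ys) (split⇒Before xs ys t∈)))
  negs′ : negs (q′ ++ [ -[1+ k ] ]) ≡ negatives (suc k)
  negs′ = begin
    negs (q′ ++ [ -[1+ k ] ])       ≡⟨ negs-++ q′ [ -[1+ k ] ] ⟩
    negs q′ ++ [ -[1+ k ] ]         ≡⟨ cong (_++ [ -[1+ k ] ]) (trans (negs-insertAt (x ∸ 1) (suc k) q) negs≡) ⟩
    negatives k ++ [ -[1+ k ] ]     ≡⟨ sym (negatives-suc k) ⟩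
    negatives (suc k)               ∎
    where open ≡-Reasoning

StandardPerm-πAux : ∀ as k acc → StandardPerm k acc → StandardPerm (length as + k) (πAux k acc as)
StandardPerm-πAux []       k acc sp = sp
StandardPerm-πAux (a ∷ as) k acc sp =
  subst (λ i → StandardPerm i (πAux (suc k) (step k acc a) as)) (+-suc (length as) k)
        (StandardPerm-πAux as (suc k) (step k acc a) (StandardPerm-step k acc a sp))

StandardPerm-π : ∀ w → StandardPerm (length w) (π w)
StandardPerm-π w = subst (λ i → StandardPerm i (π w)) (+-identityʳ (length w))
  (StandardPerm-πAux w 0 [] (↭-refl , (λ i ()) , refl))

InRange : ℕ → ℤ → Set
InRange n z = ∃ λ i → i < n × (z ≡ + suc i ⊎ z ≡ -[1+ i ])

InRange-suc : ∀ {n z} → InRange n z → InRange (suc n) z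
InRange-suc (i , i<n , z≡) = i , m<n⇒m<1+n i<n , z≡

∈signedList⇒InRange : ∀ n {z} → z ∈ signedList n → InRange n z
∈signedList⇒InRange zero ()
∈signedList⇒InRange (suc n) {z} z∈ with ∈-++⁻ (signedList n) (subst (z ∈_) (signedList-suc n) z∈)
... | inj₁ z∈n                = InRange-suc (∈signedList⇒InRange n z∈n)
... | inj₂ (here z≡)          = n , ≤-refl , inj₁ z≡
... | inj₂ (there (here z≡))  = n , ≤-refl , inj₂ z≡

zero∉signedList : ∀ n → + 0 ∉ signedList n
zero∉signedList n 0∈ with ∈signedList⇒InRange n 0∈
... | _ , _ , inj₁ ()
... | _ , _ , inj₂ ()

top∉signedList : ∀ n → + suc n ∉ signedList n
top∉signedList n z∈ with ∈signedList⇒InRange n z∈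
... | _ , n<n , inj₁ refl = <-irrefl refl n<n

-top∉signedList : ∀ n → -[1+ n ] ∉ signedList n
-top∉signedList n z∈ with ∈signedList⇒InRange n z∈
... | _ , n<n , inj₂ refl = <-irrefl refl n<n

Unique-signedList : ∀ n → Unique (signedList n)
Unique-signedList zero    = []
Unique-signedList (suc n) = subst Unique (sym (signedList-suc n))
  (Unique.++⁺ (Unique-signedList n) (((λ ()) ∷ []) ∷ [] ∷ []) disjoint)
  where
  disjoint : ∀ {v} → ¬ (v ∈ signedList n × v ∈ + suc n ∷ -[1+ n ] ∷ [])
  disjoint (v∈ , here refl)         = top∉signedList n v∈
  disjoint (v∈ , there (here refl)) = -top∉signedList n v∈

Unbalanced : List ℤ → Set
Unbalanced l = ∃ λ j → OneOf j l

odd? : ℕ → Bool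
odd? zero    = false
odd? (suc n) = not (odd? n)

unpaired⇒Unbalanced : ∀ a {l} → a ≢ + 0 → a ∈ l → - a ∉ l → Unbalanced l
unpaired⇒Unbalanced (+ zero)    a≢0 a∈ -a∉ = ⊥-elim (a≢0 refl)
unpaired⇒Unbalanced (+ suc j)   a≢0 a∈ -a∉ = suc j , inj₁ (a∈ , -a∉)
unpaired⇒Unbalanced (-[1+ j ])  a≢0 a∈ -a∉ = suc j , inj₂ (-a∉ , a∈)

-- Deleting a pair a, -a from a duplicate-free list does not create balance:
-- the witness j for the smaller list still works for the larger one.
module _ (a : ℤ) (r₁ r₂ : List ℤ) (u : Unique (a ∷ r₁ ++ - a ∷ r₂)) where

  private
    S B : List ℤ
    S = r₁ ++ r₂
    B = a ∷ r₁ ++ - a ∷ r₂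

    a∉S : a ∉ S
    a∉S a∈ = Unique.Unique[x∷xs]⇒x∉xs u (∈-delete r₁ a∈)

    -a∉S : - a ∉ S
    -a∉S = Unique.Unique[x∷xs]⇒x∉xs (Unique-shift r₁ (Unique.drop⁺ 1 u))

    partnerAbsent : ∀ {x} → x ∈ S → - x ∉ S → - x ∉ B
    partnerAbsent {x} x∈ -x∉ (here -x≡a) =
      -a∉S (subst (_∈ S) (trans (sym (neg-involutive x)) (cong -_ -x≡a)) x∈)
    partnerAbsent {x} x∈ -x∉ (there -x∈) with ∈-++⁻ r₁ -x∈
    ... | inj₁ -x∈r₁         = -x∉ (∈-++⁺ˡ -x∈r₁)
    ... | inj₂ (here -x≡-a)  = a∉S (subst (_∈ S) (neg-injective -x≡-a) x∈)
    ... | inj₂ (there -x∈r₂) = -x∉ (∈-++⁺ʳ r₁ -x∈r₂)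

  Unbalanced-pair : Unbalanced S → Unbalanced B
  Unbalanced-pair (j , inj₁ (+j∈ , -j∉)) = j , inj₁ (there (∈-delete r₁ +j∈) , partnerAbsent +j∈ -j∉)
  Unbalanced-pair (j , inj₂ (+j∉ , -j∈)) =
    j , inj₂ (subst (_∉ B) (neg-involutive (+ j)) (partnerAbsent -j∈ (subst (_∉ S) (sym (neg-involutive (+ j))) +j∉)) ,
              there (∈-delete r₁ -j∈))

self-neg : ∀ a → - a ≡ a → a ≡ + 0
self-neg (+ zero)   _  = refl
self-neg (+ suc j)  ()
self-neg (-[1+ j ]) ()

-- If the head a has no partner -a we are done; otherwise delete the
-- pair a, -a and recurse (fuel bounds the length).
Unbalanced-or-even : ∀ fuel l → length l ≤ fuel → Unique l → + 0 ∉ l →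
  Unbalanced l ⊎ odd? (length l) ≡ false
Unbalanced-or-even fuel [] _ _ _ = inj₂ refl
Unbalanced-or-even fuel (a ∷ r) len≤ u 0∉ with (- a) ∈? r
... | no -a∉r = inj₁ (unpaired⇒Unbalanced a (λ a≡0 → 0∉ (here (sym a≡0))) (here refl) -a∉)
  where
  -a∉ : - a ∉ a ∷ r
  -a∉ (here -a≡a) = 0∉ (here (sym (self-neg a -a≡a)))
  -a∉ (there -a∈) = -a∉r -a∈
... | yes -a∈r with ∈-∃++ -a∈r
...   | r₁ , r₂ , refl with subst (_≤ fuel) (length-pair a (- a) r₁ r₂) len≤
...     | s≤s (s≤s len≤′) with Unbalanced-or-even _ (r₁ ++ r₂) len≤′ (Unique-deletePair r₁ u) (λ 0∈ → 0∉ (there (∈-delete r₁ 0∈)))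
...       | inj₁ unbalanced = inj₁ (Unbalanced-pair a r₁ r₂ u unbalanced)
...       | inj₂ even       = inj₂ (trans (cong odd? (length-pair a (- a) r₁ r₂)) (trans (not-involutive _) even))

odd⇒Unbalanced : ∀ l → Unique l → + 0 ∉ l → odd? (length l) ≡ true → Unbalanced l
odd⇒Unbalanced l u 0∉ odd with Unbalanced-or-even (length l) l ≤-refl u 0∉
... | inj₁ unbalanced = unbalanced
... | inj₂ even       = ⊥-elim (true≢false (trans (sym odd) even))
  where
  true≢false : true ≢ false
  true≢false ()

PrefixesUnbalanced : List ℤ → ℕ → Set
PrefixesUnbalanced q j = ∀ t → 1 ≤ t → t ≤ j → Unbalanced (take t q)

PrefixesUnbalanced-mono : ∀ {q i j} → i ≤ j → PrefixesUnbalanced q j → PrefixesUnbalanced q i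
PrefixesUnbalanced-mono i≤j pu t 1≤t t≤i = pu t 1≤t (≤-trans t≤i i≤j)

PrefixesUnbalanced-extend : ∀ {q j} → PrefixesUnbalanced q j → Unbalanced (take (suc j) q) →
  PrefixesUnbalanced q (suc j)
PrefixesUnbalanced-extend {j = j} pu unbalanced t 1≤t t≤1+j with t ≟ suc j
... | yes refl = unbalanced
... | no t≢1+j = pu t 1≤t (≤-pred (≤∧≢⇒< t≤1+j t≢1+j))

length-step : ∀ m q j → length (step m q (suc j)) ≡ suc (suc (length q))
length-step m q j = begin
  length (insertAt j (+ suc m) q ++ [ -[1+ m ] ])   ≡⟨ length-++ (insertAt j (+ suc m) q) ⟩
  length (insertAt j (+ suc m) q) + 1               ≡⟨ cong (_+ 1) (length-insertAt j (+ suc m) q) ⟩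
  suc (length q) + 1                                ≡⟨ +-comm (suc (length q)) 1 ⟩
  suc (suc (length q))                              ∎
  where open ≡-Reasoning

-- Connectivity criterion for one step of π: inserting m+1 at index j (and
-- appending -(m+1)) yields a sign-connected word iff the prefixes of q of
-- length ≤ j are unbalanced; the longer prefixes contain m+1 but not -(m+1).
connected⇒prefixes : ∀ m q j → j ≤ length q → SignConnected (step m q (suc j)) → PrefixesUnbalanced q j
connected⇒prefixes m q j j≤ connected t 1≤t t≤j =
  subst Unbalanced (take-insertAt (+ suc m) t j q [ -[1+ m ] ] t≤j t≤q)
    (connected t 1≤t (subst (t <_) (sym (length-step m q j)) (s≤s (m≤n⇒m≤1+n t≤q))))
  where
  t≤q : t ≤ length q
  t≤q = ≤-trans t≤j j≤

prefixes⇒connected : ∀ m q j → j ≤ length q → -[1+ m ] ∉ q → PrefixesUnbalanced q j → SignConnected (step m q (suc j))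
prefixes⇒connected m q j j≤ -z∉q pu t 1≤t t<len with t ≤? j
... | yes t≤j = subst Unbalanced (sym (take-insertAt (+ suc m) t j q [ -[1+ m ] ] t≤j (≤-trans t≤j j≤))) (pu t 1≤t t≤j)
... | no t≰j  = suc m , inj₁ (∈-take-insertAt (+ suc m) t j q [ -[1+ m ] ] (≰⇒> t≰j) , -z∉)
  where
  q′ : List ℤ
  q′ = insertAt j (+ suc m) q
  t≤q′ : t ≤ length q′
  t≤q′ = subst (t ≤_) (sym (length-insertAt j (+ suc m) q)) (≤-pred (subst (t <_) (length-step m q j) t<len))
  -z∉ : -[1+ m ] ∉ take t (q′ ++ [ -[1+ m ] ])
  -z∉ -z∈ with ∈-insertAt⁻ j (+ suc m) q (∈-take t q′ (subst (-[1+ m ] ∈_) (take-++ t q′ [ -[1+ m ] ] t≤q′) -z∈))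
  ... | inj₂ -z∈q = -z∉q -z∈q

step-connected-first : ∀ m q → -[1+ m ] ∉ q → SignConnected (step m q 1)
step-connected-first m q -z∉q = prefixes⇒connected m q 0 z≤n -z∉q (λ t 1≤t t≤0 → ⊥-elim (<-irrefl refl (≤-trans 1≤t t≤0)))

step-connected-down : ∀ m q {i j} → i ≤ j → j ≤ length q → -[1+ m ] ∉ q →
  SignConnected (step m q (suc j)) → SignConnected (step m q (suc i))
step-connected-down m q i≤j j≤ -z∉q connected =
  prefixes⇒connected m q _ (≤-trans i≤j j≤) -z∉q (PrefixesUnbalanced-mono i≤j (connected⇒prefixes m q _ j≤ connected))

Unbalanced-↭ : ∀ {l l′} → l ↭ l′ → Unbalanced l → Unbalanced l′
Unbalanced-↭ l↭l′ (j , inj₁ (+j∈ , -j∉)) = j , inj₁ (∈-resp-↭ l↭l′ +j∈ , λ -j∈ → -j∉ (∈-resp-↭ (↭-sym l↭l′) -j∈))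
Unbalanced-↭ l↭l′ (j , inj₂ (+j∉ , -j∈)) = j , inj₂ ((λ +j∈ → +j∉ (∈-resp-↭ (↭-sym l↭l′) +j∈)) , ∈-resp-↭ l↭l′ -j∈)

take-swap-↭ : ∀ {A B : ℤ} {ys} xs t → t ≢ suc (length xs) → take t (xs ++ A ∷ B ∷ ys) ↭ take t (xs ++ B ∷ A ∷ ys)
take-swap-↭ []       zero          _ = ↭-refl
take-swap-↭ []       (suc zero)    t≢1 = ⊥-elim (t≢1 refl)
take-swap-↭ {A} {B} [] (suc (suc t)) _ = swap A B ↭-refl
take-swap-↭ (x ∷ xs) zero          _ = ↭-refl
take-swap-↭ (x ∷ xs) (suc t)       t≢ = prep x (take-swap-↭ xs t (λ t≡ → t≢ (cong suc t≡)))

SwapUnbalanced : List ℤ → ℤ → ℤ → Set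
SwapUnbalanced xs A B = Unbalanced (xs ++ [ A ]) × Unbalanced (xs ++ [ B ]) × Unbalanced (xs ++ A ∷ B ∷ [])

-- q′ arises from q by swapping two adjacent entries; a strong swap moreover
-- has unbalanced prefixes around the swapped pair.  Consecutive entries of
-- G n are related by swaps that are alternately strong and weak.
Swap : Bool → List ℤ → List ℤ → Set
Swap strong q q′ = ∃ λ xs → ∃ λ A → ∃ λ B → ∃ λ ys →
  (q ≡ xs ++ A ∷ B ∷ ys) × (q′ ≡ xs ++ B ∷ A ∷ ys) × (strong ≡ true → SwapUnbalanced xs A B)

Swap⇒AdjTransp : ∀ {b q q′} → Swap b q q′ → AdjTransp q q′
Swap⇒AdjTransp (xs , A , B , ys , q≡ , q′≡ , _) = xs , ys , A , B , q≡ , q′≡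

AdjTransp-++ : ∀ {p q} r → AdjTransp p q → AdjTransp (p ++ r) (q ++ r)
AdjTransp-++ r (xs , ys , a , b , refl , refl) =
  xs , ys ++ r , a , b , ++-assoc xs (a ∷ b ∷ ys) r , ++-assoc xs (b ∷ a ∷ ys) r

PrefixesUnbalanced-swap : ∀ {A B ys} xs j → Unbalanced (xs ++ [ B ]) →
  PrefixesUnbalanced (xs ++ A ∷ B ∷ ys) j → PrefixesUnbalanced (xs ++ B ∷ A ∷ ys) j
PrefixesUnbalanced-swap {A} {B} {ys} xs j unbalancedB pu t 1≤t t≤j with t ≟ suc (length xs)
... | yes refl = subst Unbalanced (sym (take-+-length xs 1 (B ∷ A ∷ ys))) unbalancedB
... | no t≢    = Unbalanced-↭ (take-swap-↭ xs t t≢) (pu t 1≤t t≤j)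

MaxConnected : ℕ → List ℤ → ℕ → Set
MaxConnected m q j = j ≤ length q × SignConnected (step m q (suc j)) ×
  (j < length q → ¬ SignConnected (step m q (suc (suc j))))

below-max : ∀ m q {i j} → -[1+ m ] ∉ q → MaxConnected m q j → i ≤ length q → PrefixesUnbalanced q i → i ≤ j
below-max m q {i} {j} -z∉q (j≤ , _ , maximal) i≤ pu with i ≤? j
... | yes i≤j = i≤j
... | no i≰j  = ⊥-elim (maximal j<q (prefixes⇒connected m q (suc j) j<q -z∉q (PrefixesUnbalanced-mono j<i pu)))
  where
  j<i : j < i
  j<i = ≰⇒> i≰j
  j<q : j < length q
  j<q = <-≤-trans j<i i≤

insertAt-swap : ∀ m {A B : ℤ} xs ys j → j ≢ suc (length xs) →
  AdjTransp (step m (xs ++ A ∷ B ∷ ys) (suc j)) (step m (xs ++ B ∷ A ∷ ys) (suc j))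
insertAt-swap m {A} {B} xs ys j j≢ with <-cmp j (suc (length xs))
... | tri< j<  _ _ = AdjTransp-++ [ -[1+ m ] ]
  (insertAt j z xs , ys , A , B , insertAt-++ j z xs (A ∷ B ∷ ys) (≤-pred j<) , insertAt-++ j z xs (B ∷ A ∷ ys) (≤-pred j<))
  where
  z : ℤ
  z = + suc m
... | tri≈ _ j≡ _ = ⊥-elim (j≢ j≡)
... | tri> _ _ j> = AdjTransp-++ [ -[1+ m ] ] (xs , insertAt d z ys , A , B , shifted A B , shifted B A)
  where
  z : ℤ
  z = + suc m
  d : ℕ
  d = j ∸ suc (suc (length xs))
  j≡ : j ≡ length xs + suc (suc d)
  j≡ = begin
    j                                  ≡⟨ sym (m+[n∸m]≡n j>) ⟩
    suc (suc (length xs)) + d          ≡⟨ cong suc (sym (+-suc (length xs) d)) ⟩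
    suc (length xs + suc d)            ≡⟨ sym (+-suc (length xs) (suc d)) ⟩
    length xs + suc (suc d)            ∎
    where open ≡-Reasoning
  shifted : ∀ a b → insertAt j z (xs ++ a ∷ b ∷ ys) ≡ xs ++ a ∷ b ∷ insertAt d z ys
  shifted a b = trans (cong (λ i → insertAt i z (xs ++ a ∷ b ∷ ys)) j≡) (insertAt-shift z xs (a ∷ b ∷ ys) (suc (suc d)))

-- Let q, q′ differ by a strong swap, and let j, j′ be the
-- maximal connected insertion indices.  Unbalanced prefixes transfer across
-- the swap, so j = j′; and j is not the index between the swapped entries,
-- since the prefix through the pair is unbalanced.
max-connected-swap : ∀ m {q q′ j j′} → -[1+ m ] ∉ q → -[1+ m ] ∉ q′ → Swap true q q′ →
  MaxConnected m q j → MaxConnected m q′ j′ → AdjTransp (step m q (suc j)) (step m q′ (suc j′))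
max-connected-swap m {j = j} {j′} -z∉q -z∉q′ (xs , A , B , ys , refl , refl , strong) maxj maxj′ =
  subst (λ i → AdjTransp (step m q (suc j)) (step m q′ (suc i))) j≡j′ (insertAt-swap m xs ys j j≢)
  where
  q q′ : List ℤ
  q  = xs ++ A ∷ B ∷ ys
  q′ = xs ++ B ∷ A ∷ ys
  unbalancedA : Unbalanced (xs ++ [ A ])
  unbalancedA = proj₁ (strong refl)
  unbalancedB : Unbalanced (xs ++ [ B ])
  unbalancedB = proj₁ (proj₂ (strong refl))
  unbalancedAB : Unbalanced (xs ++ A ∷ B ∷ [])
  unbalancedAB = proj₂ (proj₂ (strong refl))
  j≤q : j ≤ length q
  j≤q = proj₁ maxj
  j′≤q′ : j′ ≤ length q′
  j′≤q′ = proj₁ maxj′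
  pu : PrefixesUnbalanced q j
  pu = connected⇒prefixes m q j j≤q (proj₁ (proj₂ maxj))
  pu′ : PrefixesUnbalanced q′ j′
  pu′ = connected⇒prefixes m q′ j′ j′≤q′ (proj₁ (proj₂ maxj′))
  j≡j′ : j ≡ j′
  j≡j′ = ≤-antisym
    (below-max m q′ -z∉q′ maxj′ (subst (j ≤_) (length-swap xs ys) j≤q) (PrefixesUnbalanced-swap xs j unbalancedB pu))
    (below-max m q -z∉q maxj (subst (j′ ≤_) (sym (length-swap xs ys)) j′≤q′) (PrefixesUnbalanced-swap xs j′ unbalancedA pu′))
  j≢ : j ≢ suc (length xs)
  j≢ refl = proj₂ (proj₂ maxj) (pair-inside xs ys)
    (prefixes⇒connected m q (suc j) (pair-inside xs ys) -z∉q
      (PrefixesUnbalanced-extend pu (subst Unbalanced (sym (take-+-length xs 2 (A ∷ B ∷ ys))) unbalancedAB)))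

Swap-sym : ∀ {b q q′} → Swap b q q′ → Swap b q′ q
Swap-sym (xs , A , B , ys , q≡ , q′≡ , strong) = xs , B , A , ys , q′≡ , q≡ , flip
  where
  flip : _ ≡ true → SwapUnbalanced xs B A
  flip b≡true with strong b≡true
  ... | unbalancedA , unbalancedB , unbalancedAB = unbalancedB , unbalancedA , Unbalanced-↭ (++⁺ˡ xs (swap A B ↭-refl)) unbalancedAB

fresh⇒Unbalanced : ∀ m {l} → + suc m ∈ l → -[1+ m ] ∉ l → Unbalanced l
fresh⇒Unbalanced m z∈ -z∉ = suc m , inj₁ (z∈ , -z∉)

step-after-prefix : ∀ m pre r d →
  step m (pre ++ r) (suc (length pre + d)) ≡ pre ++ insertAt d (+ suc m) r ++ [ -[1+ m ] ]
step-after-prefix m pre r d =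
  trans (cong (_++ [ -[1+ m ] ]) (insertAt-shift (+ suc m) pre r d)) (++-assoc pre (insertAt d (+ suc m) r) [ -[1+ m ] ])

-- Inside a block: moving the inserted entry m+1 one place to the right is a
-- swap with the entry a at index j, and this swap is strong when j+1 is odd:
-- then the prefix ending in a has odd length, hence is unbalanced by parity.
swap-in-block : ∀ m q j → j < length q → Unique q → + 0 ∉ q → -[1+ m ] ∉ q →
  Swap (odd? (suc j)) (step m q (suc j)) (step m q (suc (suc j)))
swap-in-block m q j j<q u 0∉q -z∉q with split-at j q j<q
... | pre , a , post , refl , refl =
  pre , z , a , post ++ [ -[1+ m ] ] ,
  stepAt 0 (length pre) (sym (+-identityʳ _)) , stepAt 1 (suc (length pre)) (+-comm 1 (length pre)) , strong
  where
  z : ℤ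
  z = + suc m
  stepAt : ∀ d i → i ≡ length pre + d →
    step m (pre ++ a ∷ post) (suc i) ≡ pre ++ insertAt d z (a ∷ post) ++ [ -[1+ m ] ]
  stepAt d i refl = step-after-prefix m pre (a ∷ post) d
  prefix≡ : take (suc (length pre)) (pre ++ a ∷ post) ≡ pre ++ [ a ]
  prefix≡ = take-+-length pre 1 (a ∷ post)
  inPrefix : ∀ {t} → t ∈ pre ++ [ a ] → t ∈ pre ++ a ∷ post
  inPrefix {t} t∈ = ∈-take (suc (length pre)) (pre ++ a ∷ post) (subst (t ∈_) (sym prefix≡) t∈)
  length-prefix : length (pre ++ [ a ]) ≡ suc (length pre)
  length-prefix = trans (length-++ pre) (+-comm (length pre) 1)
  -z∉z : -[1+ m ] ∉ pre ++ [ z ]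
  -z∉z -z∈ with ∈-++⁻ pre -z∈
  ... | inj₁ -z∈pre = -z∉q (∈-++⁺ˡ -z∈pre)
  ... | inj₂ (here ())
  -z∉za : -[1+ m ] ∉ pre ++ z ∷ a ∷ []
  -z∉za -z∈ with ∈-++⁻ pre -z∈
  ... | inj₁ -z∈pre              = -z∉q (∈-++⁺ˡ -z∈pre)
  ... | inj₂ (here ())
  ... | inj₂ (there (here -z≡a)) = -z∉q (∈-++⁺ʳ pre (here -z≡a))
  strong : odd? (suc (length pre)) ≡ true → SwapUnbalanced pre z a
  strong odd =
    fresh⇒Unbalanced m (∈-++⁺ʳ pre (here refl)) -z∉z ,
    odd⇒Unbalanced (pre ++ [ a ]) (subst Unique prefix≡ (Unique.take⁺ (suc (length pre)) u))
      (λ 0∈ → 0∉q (inPrefix 0∈)) (trans (cong odd? length-prefix) odd) ,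
    fresh⇒Unbalanced m (∈-++⁺ʳ pre (here refl)) -z∉za

step-end : ∀ m q → step m q (suc (length q)) ≡ q ++ + suc m ∷ -[1+ m ] ∷ []
step-end m q = trans (cong (_++ [ -[1+ m ] ]) (insertAt-end (+ suc m) q)) (++-assoc q [ + suc m ] [ -[1+ m ] ])

swap-at-end : ∀ m {b q q′} → Swap b q q′ → Swap b (step m q (suc (length q))) (step m q′ (suc (length q′)))
swap-at-end m (xs , A , B , ys , refl , refl , strong) =
  xs , A , B , ys ++ tail ,
  trans (step-end m (xs ++ A ∷ B ∷ ys)) (++-assoc xs (A ∷ B ∷ ys) tail) ,
  trans (step-end m (xs ++ B ∷ A ∷ ys)) (++-assoc xs (B ∷ A ∷ ys) tail) , strong
  where
  tail : List ℤ
  tail = + suc m ∷ -[1+ m ] ∷ []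

swap-at-front : ∀ m {b q q′} → Swap b q q′ → Swap false (step m q 1) (step m q′ 1)
swap-at-front m (xs , A , B , ys , refl , refl , _) =
  + suc m ∷ xs , A , B , ys ++ [ -[1+ m ] ] ,
  cong (+ suc m ∷_) (++-assoc xs (A ∷ B ∷ ys) [ -[1+ m ] ]) ,
  cong (+ suc m ∷_) (++-assoc xs (B ∷ A ∷ ys) [ -[1+ m ] ]) , λ ()

-- For a predicate P and a relation R on the
-- entries of a list, Good L says: whenever two entries satisfy P and every
-- entry strictly between them fails P, the first is R-related to the second.
module Filtered {A : Set} (P : A → Set) (R : A → A → Set) where

  -- The first entry of L satisfying P, if any, is R-related to a.
  Next : A → List A → Set
  Next a []      = ⊤
  Next a (b ∷ L) = (P b → R a b) × (¬ P b → Next a L)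

  Good : List A → Set
  Good []      = ⊤
  Good (a ∷ L) = (P a → Next a L) × Good L

  NoneP : List A → Set
  NoneP = All (λ b → ¬ P b)

  -- The glue needed to concatenate: the last P-entry of X (the one followed
  -- only by entries failing P) sees the first P-entry of Y.
  Junction : List A → List A → Set
  Junction []      Y = ⊤
  Junction (a ∷ X) Y = (P a → NoneP X → Next a Y) × Junction X Y

  Next-NoneP : ∀ {a} L → NoneP L → Next a L
  Next-NoneP []      _          = tt
  Next-NoneP (b ∷ L) (¬b ∷ ¬L) = (λ b∈P → ⊥-elim (¬b b∈P)) , (λ _ → Next-NoneP L ¬L)

  Next-++ : ∀ {a} X {Y} → Next a X → (NoneP X → Next a Y) → Next a (X ++ Y)
  Next-++ []      _                   next-Y = next-Y []
  Next-++ (b ∷ X) (related , skip) next-Y =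
    related , (λ ¬b → Next-++ X (skip ¬b) (λ ¬X → next-Y (¬b ∷ ¬X)))

  Good-++ : ∀ X {Y} → Good X → Good Y → Junction X Y → Good (X ++ Y)
  Good-++ []      _                  good-Y _                    = good-Y
  Good-++ (a ∷ X) (next-a , good-X) good-Y (junction-a , junction) =
    (λ a∈P → Next-++ X (next-a a∈P) (junction-a a∈P)) , Good-++ X good-X good-Y junction

  Junction-[] : ∀ X → Junction X []
  Junction-[] []      = tt
  Junction-[] (a ∷ X) = (λ _ _ → tt) , Junction-[] X

  Next-lookup : ∀ {a} L → Next a L → (j : Fin (length L)) → P (lookup L j) →
    ((k : Fin (length L)) → toℕ k < toℕ j → ¬ P (lookup L k)) → R a (lookup L j)
  Next-lookup (b ∷ L) (related , skip) fzero    j∈P before = related j∈P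
  Next-lookup (b ∷ L) (related , skip) (fsuc j) j∈P before =
    Next-lookup L (skip (before fzero (s≤s z≤n))) j j∈P (λ k k<j → before (fsuc k) (s≤s k<j))

  Good-lookup : ∀ L → Good L → (i j : Fin (length L)) → toℕ i < toℕ j →
    P (lookup L i) → P (lookup L j) →
    ((k : Fin (length L)) → toℕ i < toℕ k → toℕ k < toℕ j → ¬ P (lookup L k)) →
    R (lookup L i) (lookup L j)
  Good-lookup (a ∷ L) (next-a , good) fzero (fsuc j) _ i∈P j∈P between =
    Next-lookup L (next-a i∈P) j j∈P (λ k k<j → between (fsuc k) (s≤s z≤n) (s≤s k<j))
  Good-lookup (a ∷ L) (next-a , good) (fsuc i) (fsuc j) (s≤s i<j) i∈P j∈P between =
    Good-lookup L good i j i<j i∈P j∈P (λ k i<k k<j → between (fsuc k) (s≤s i<k) (s≤s k<j))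

  DownClosed : (ℕ → A) → ℕ → Set
  DownClosed g c = ∀ {i j} → i ≤ j → j < c → P (g j) → P (g i)

  private
    DownClosed-shift : ∀ {g c} → DownClosed g (suc c) → DownClosed (λ j → g (suc j)) c
    DownClosed-shift down i≤j j<c = down (s≤s i≤j) (s≤s j<c)

    DownClosed-restrict : ∀ {g c} → DownClosed g (suc c) → DownClosed g c
    DownClosed-restrict down i≤j j<c = down i≤j (m<n⇒m<1+n j<c)

  NoneP-applyUpTo : ∀ g c → (∀ j → j < c → ¬ P (g j)) → NoneP (applyUpTo g c)
  NoneP-applyUpTo g zero    none = []
  NoneP-applyUpTo g (suc c) none = none 0 (s≤s z≤n) ∷ NoneP-applyUpTo (λ j → g (suc j)) c (λ j j<c → none (suc j) (s≤s j<c))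

  -- Walking up a family with an initial segment of P-entries, consecutive
  -- entries must be related; past the segment nothing is left to check.
  Good-applyUpTo : ∀ g c → DownClosed g c → (∀ j → suc j < c → R (g j) (g (suc j))) → Good (applyUpTo g c)
  Good-applyUpTo g zero    down related = tt
  Good-applyUpTo g (suc c) down related =
    next c down related , Good-applyUpTo (λ j → g (suc j)) c (DownClosed-shift down) (λ j j<c → related (suc j) (s≤s j<c))
    where
    next : ∀ c → DownClosed g (suc c) → (∀ j → suc j < suc c → R (g j) (g (suc j))) →
      P (g 0) → Next (g 0) (applyUpTo (λ j → g (suc j)) c)
    next zero     _    _       _ = tt
    next (suc c′) down related _ =
      (λ _ → related 0 (s≤s (s≤s z≤n))) ,
      (λ ¬g1 → Next-NoneP _ (NoneP-applyUpTo _ c′ (λ j j<c′ g₂₊ⱼ → ¬g1 (down (s≤s z≤n) (s≤s (s≤s j<c′)) g₂₊ⱼ))))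

  -- Walking down, the entry after a P-entry is again a P-entry.
  Good-applyDownFrom : ∀ g c → DownClosed g c → (∀ j → suc j < c → R (g (suc j)) (g j)) → Good (applyDownFrom g c)
  Good-applyDownFrom g zero    down related = tt
  Good-applyDownFrom g (suc c) down related =
    next c down related ,
    Good-applyDownFrom g c (DownClosed-restrict down) (λ j j<c → related j (m<n⇒m<1+n j<c))
    where
    next : ∀ c → DownClosed g (suc c) → (∀ j → suc j < suc c → R (g (suc j)) (g j)) →
      P (g c) → Next (g c) (applyDownFrom g c)
    next zero     _    _       _   = tt
    next (suc c′) down related gc  =
      (λ _ → related c′ ≤-refl) , (λ ¬gc′ → ⊥-elim (¬gc′ (down (n≤1+n c′) ≤-refl gc)))

  Junction-applyUpTo : ∀ g c {Y} →
    (∀ j → j < c → P (g j) → (suc j < c → ¬ P (g (suc j))) → Next (g j) Y) → Junction (applyUpTo g c) Y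
  Junction-applyUpTo g zero    next = tt
  Junction-applyUpTo g (suc c) next =
    (λ g0 none → next 0 (s≤s z≤n) g0 (first-fails c none)) ,
    Junction-applyUpTo (λ j → g (suc j)) c (λ j j<c gj max → next (suc j) (s≤s j<c) gj (λ { (s≤s sj<c) → max sj<c }))
    where
    first-fails : ∀ c → NoneP (applyUpTo (λ j → g (suc j)) c) → 1 < suc c → ¬ P (g 1)
    first-fails zero     _          (s≤s ())
    first-fails (suc c′) (¬g1 ∷ _) _ = ¬g1

  NoneP-applyDownFrom : ∀ g c → P (g 0) → ¬ NoneP (applyDownFrom g (suc c))
  NoneP-applyDownFrom g zero    g0 (¬g0 ∷ []) = ¬g0 g0
  NoneP-applyDownFrom g (suc c) g0 (_ ∷ none) = NoneP-applyDownFrom g c g0 none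

  Junction-applyDownFrom : ∀ g c {Y} → P (g 0) → Next (g 0) Y → Junction (applyDownFrom g c) Y
  Junction-applyDownFrom g zero    g0 next = tt
  Junction-applyDownFrom g (suc c) g0 next =
    (λ _ none → last c none) , Junction-applyDownFrom g c g0 next
    where
    last : ∀ c → NoneP (applyDownFrom g c) → Next (g c) _
    last zero     _    = next
    last (suc c′) none = ⊥-elim (NoneP-applyDownFrom g c′ g0 none)

  Next-applyDownFrom : ∀ {a} g c →
    (∀ j → j < c → P (g j) → (suc j < c → ¬ P (g (suc j))) → R a (g j)) → Next a (applyDownFrom g c)
  Next-applyDownFrom g zero    related = tt
  Next-applyDownFrom g (suc c) related =
    (λ gc → related c ≤-refl gc (λ c<c → ⊥-elim (<-irrefl refl (≤-pred c<c)))) ,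
    (λ ¬gc → Next-applyDownFrom g c (λ j j<c gj max → related j (m<n⇒m<1+n j<c) gj (above ¬gc j<c max)))
    where
    above : ∀ {j} → ¬ P (g c) → j < c → (suc j < c → ¬ P (g (suc j))) → suc j < suc c → ¬ P (g (suc j))
    above ¬gc j<c max _ with m≤n⇒m<n∨m≡n j<c
    ... | inj₁ sj<c = max sj<c
    ... | inj₂ refl = ¬gc

module Alternating {A : Set} (S : Bool → A → A → Set) where

  Chain : Bool → List A → Set
  Chain b []           = ⊤
  Chain b (a ∷ [])     = ⊤
  Chain b (a ∷ a′ ∷ L) = S b a a′ × Chain (not b) (a′ ∷ L)

  Chain-applyUpTo : ∀ (F : ℕ → Bool) g c Y → (∀ j → F (suc j) ≡ not (F j)) →
    (∀ j → j < c → S (F j) (g j) (g (suc j))) → Chain (F c) (g c ∷ Y) → Chain (F 0) (applyUpTo g (suc c) ++ Y)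
  Chain-applyUpTo F g zero    Y alternate related chain = chain
  Chain-applyUpTo F g (suc c) Y alternate related chain =
    related 0 (s≤s z≤n) ,
    subst (λ b → Chain b (applyUpTo (λ j → g (suc j)) (suc c) ++ Y)) (alternate 0)
      (Chain-applyUpTo (λ j → F (suc j)) (λ j → g (suc j)) c Y (λ j → alternate (suc j))
        (λ j j<c → related (suc j) (s≤s j<c)) chain)

  Chain-applyDownFrom : ∀ (F : ℕ → Bool) g c Y → (∀ j → F (suc j) ≡ not (F j)) →
    (∀ j → j < c → S (F (suc j)) (g (suc j)) (g j)) → Chain (F 0) (g 0 ∷ Y) → Chain (F c) (applyDownFrom g (suc c) ++ Y)
  Chain-applyDownFrom F g zero    Y alternate related chain = chain
  Chain-applyDownFrom F g (suc c) Y alternate related chain =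
    related c ≤-refl ,
    subst (λ b → Chain b (applyDownFrom g (suc c) ++ Y)) (sym (trans (cong not (alternate c)) (not-involutive (F c))))
      (Chain-applyDownFrom F g c Y alternate (λ j j<c → related j (m<n⇒m<1+n j<c)) chain)

-- The structure of G.  G (n+1) lists, for the m-th word w of G n, the block
-- w1, …, wK (m odd) or wK, …, w1 (m even), where K = 2n+1; we write
-- extend w j for the word w(j+1).
extend : List ℕ → ℕ → List ℕ
extend w j = w ++ [ suc j ]

Blocks : Bool → ℕ → List (List ℕ) → List (List ℕ)
Blocks b     K []       = []
Blocks true  K (w ∷ ws) = applyUpTo (extend w) K ++ Blocks false K ws
Blocks false K (w ∷ ws) = applyDownFrom (extend w) K ++ Blocks true K ws

blocks≡Blocks : ∀ b K L → blocks b K L ≡ Blocks b K L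
blocks≡Blocks b     K []       = refl
blocks≡Blocks true  K (w ∷ ws) = cong₂ _++_ (ascending w K) (blocks≡Blocks false K ws)
  where
  ascending : ∀ w K → map (λ x → w ++ [ x ]) (range K) ≡ applyUpTo (extend w) K
  ascending w K = trans (cong (map _) (map-upTo suc K)) (map-applyUpTo suc (λ x → w ++ [ x ]) K)
blocks≡Blocks false K (w ∷ ws) = cong₂ _++_ descending (blocks≡Blocks true K ws)
  where
  descending : map (λ x → w ++ [ x ]) (reverse (range K)) ≡ applyDownFrom (extend w) K
  descending = begin
    map (λ x → w ++ [ x ]) (reverse (range K))    ≡⟨ reverse-map (λ x → w ++ [ x ]) (range K) ⟩
    reverse (map (λ x → w ++ [ x ]) (range K))    ≡⟨ cong reverse (trans (cong (map _) (map-upTo suc K)) (map-applyUpTo suc (λ x → w ++ [ x ]) K)) ⟩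
    reverse (applyUpTo (extend w) K)             ≡⟨ reverse-applyUpTo (extend w) K ⟩
    applyDownFrom (extend w) K                   ∎
    where open ≡-Reasoning

G-suc : ∀ n → G (suc n) ≡ Blocks true (suc (n + n)) (G n)
G-suc n = trans (blocks≡Blocks true _ (G n)) (cong (λ K → Blocks true K (G n)) K≡)
  where
  K≡ : 2 * suc n ∸ 1 ≡ suc (n + n)
  K≡ = trans (cong (λ k → n + suc k) (+-identityʳ n)) (+-suc n n)

∈-Blocks⁻ : ∀ b K L {a} → a ∈ Blocks b K L → ∃ λ v → ∃ λ j → v ∈ L × j < K × a ≡ extend v j
∈-Blocks⁻ true  K (w ∷ ws) a∈ with ∈-++⁻ (applyUpTo (extend w) K) a∈
... | inj₁ a∈w with SetoidMembership.∈-applyUpTo⁻ (setoid _) (extend w) a∈w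
...   | j , j<K , a≡ = w , j , here refl , j<K , a≡
∈-Blocks⁻ true  K (w ∷ ws) a∈ | inj₂ a∈ws with ∈-Blocks⁻ false K ws a∈ws
... | v , j , v∈ , j<K , a≡ = v , j , there v∈ , j<K , a≡
∈-Blocks⁻ false K (w ∷ ws) a∈ with ∈-++⁻ (applyDownFrom (extend w) K) a∈
... | inj₁ a∈w with SetoidMembership.∈-applyDownFrom⁻ (setoid _) (extend w) a∈w
...   | j , j<K , a≡ = w , j , here refl , j<K , a≡
∈-Blocks⁻ false K (w ∷ ws) a∈ | inj₂ a∈ws with ∈-Blocks⁻ true K ws a∈ws
... | v , j , v∈ , j<K , a≡ = v , j , there v∈ , j<K , a≡

∈-Blocks⁺ : ∀ b K L {v j} → v ∈ L → j < K → extend v j ∈ Blocks b K L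
∈-Blocks⁺ true  K (w ∷ ws) (here refl) j<K = ∈-++⁺ˡ (SetoidMembership.∈-applyUpTo⁺ (setoid _) (extend w) j<K)
∈-Blocks⁺ true  K (w ∷ ws) (there v∈)  j<K = ∈-++⁺ʳ (applyUpTo (extend w) K) (∈-Blocks⁺ false K ws v∈ j<K)
∈-Blocks⁺ false K (w ∷ ws) (here refl) j<K = ∈-++⁺ˡ (SetoidMembership.∈-applyDownFrom⁺ (setoid _) (extend w) j<K)
∈-Blocks⁺ false K (w ∷ ws) (there v∈)  j<K = ∈-++⁺ʳ (applyDownFrom (extend w) K) (∈-Blocks⁺ true K ws v∈ j<K)

∈-G-suc⁻ : ∀ n {w} → w ∈ G (suc n) → ∃ λ v → ∃ λ j → v ∈ G n × j ≤ n + n × w ≡ extend v j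
∈-G-suc⁻ n {w} w∈ with ∈-Blocks⁻ true _ (G n) (subst (w ∈_) (G-suc n) w∈)
... | v , j , v∈ , j<K , w≡ = v , j , v∈ , ≤-pred j<K , w≡

∈-G-suc⁺ : ∀ n {v j} → v ∈ G n → j ≤ n + n → extend v j ∈ G (suc n)
∈-G-suc⁺ n {v} {j} v∈ j≤ = subst (extend v j ∈_) (sym (G-suc n)) (∈-Blocks⁺ true _ (G n) v∈ (s≤s j≤))

length-∈G : ∀ n {w} → w ∈ G n → length w ≡ n
length-∈G zero    (here refl) = refl
length-∈G (suc n) w∈ with ∈-G-suc⁻ n w∈
... | v , j , v∈ , _ , refl = trans (length-++ v) (trans (+-comm (length v) 1) (cong suc (length-∈G n v∈)))

length-signedList : ∀ n → length (signedList n) ≡ n + n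
length-signedList zero    = refl
length-signedList (suc n) = begin
  length (signedList (suc n))                            ≡⟨ cong length (signedList-suc n) ⟩
  length (signedList n ++ + suc n ∷ -[1+ n ] ∷ [])       ≡⟨ length-++ (signedList n) ⟩
  length (signedList n) + 2                              ≡⟨ cong (_+ 2) (length-signedList n) ⟩
  n + n + 2                                              ≡⟨ +-comm (n + n) 2 ⟩
  suc (suc (n + n))                                      ≡⟨ cong suc (sym (+-suc n n)) ⟩
  suc (n + suc n)                                        ∎
  where open ≡-Reasoning

odd?-double : ∀ n → odd? (n + n) ≡ false
odd?-double zero    = refl
odd?-double (suc n) = trans (cong (λ k → not (odd? k)) (+-suc n n)) (trans (not-involutive (odd? (n + n))) (odd?-double n))

module _ {n : ℕ} (w : List ℕ) (len : length w ≡ n) where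

  π-↭ : π w ↭ signedList n
  π-↭ = subst (λ k → π w ↭ signedList k) len (proj₁ (StandardPerm-π w))

  length-π : length (π w) ≡ n + n
  length-π = trans (↭-length π-↭) (length-signedList n)

  Unique-π : Unique (π w)
  Unique-π = Unique-↭ (↭-sym π-↭) (Unique-signedList n)

  zero∉π : + 0 ∉ π w
  zero∉π 0∈ = zero∉signedList n (∈-resp-↭ π-↭ 0∈)

  top∉π : + suc n ∉ π w
  top∉π z∈ = top∉signedList n (∈-resp-↭ π-↭ z∈)

  -top∉π : -[1+ n ] ∉ π w
  -top∉π -z∈ = -top∉signedList n (∈-resp-↭ π-↭ -z∈)

  π-extend : ∀ j → π (extend w j) ≡ step n (π w) (suc j)
  π-extend j = trans (π-snoc w (suc j)) (cong (λ k → step k (π w) (suc j)) len)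

ArcAdjacent : List ℕ → List ℕ → Set
ArcAdjacent a b = AdjTransp (π a) (π b)

SwapOfπ : Bool → List ℕ → List ℕ → Set
SwapOfπ b a a′ = Swap b (π a) (π a′)

open Filtered ArcConnected ArcAdjacent
open Alternating SwapOfπ

-- Passing from G n to G (n+1): every block has K′ + 1 = 2n+1 entries.
module Level (n : ℕ) where

  K′ : ℕ
  K′ = n + n

  odd-K : odd? (suc K′) ≡ true
  odd-K = cong not (odd?-double n)

  module Word (w : List ℕ) (len : length w ≡ n) where

    toStep : ∀ {j} → ArcConnected (extend w j) → SignConnected (step n (π w) (suc j))
    toStep {j} = subst SignConnected (π-extend w len j)

    fromStep : ∀ {j} → SignConnected (step n (π w) (suc j)) → ArcConnected (extend w j)
    fromStep {j} = subst SignConnected (sym (π-extend w len j))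

    below-K : ∀ {j} → j < suc K′ → j ≤ length (π w)
    below-K j<K = subst (_ ≤_) (sym (length-π w len)) (≤-pred j<K)

    first-connected : ArcConnected (extend w 0)
    first-connected = fromStep (step-connected-first n (π w) (-top∉π w len))

    down-closed : DownClosed (extend w) (suc K′)
    down-closed i≤j j<K connected = fromStep (step-connected-down n (π w) i≤j (below-K j<K) (-top∉π w len) (toStep connected))

    swap-next : ∀ j → suc j < suc K′ → SwapOfπ (odd? (suc j)) (extend w j) (extend w (suc j))
    swap-next j sj<K = subst₂ (Swap _) (sym (π-extend w len j)) (sym (π-extend w len (suc j)))
      (swap-in-block n (π w) j (below-K sj<K) (Unique-π w len) (zero∉π w len) (-top∉π w len))

    max-connected : ∀ j → j < suc K′ → ArcConnected (extend w j) →
      (suc j < suc K′ → ¬ ArcConnected (extend w (suc j))) → MaxConnected n (π w) j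
    max-connected j j<K connected maximal = below-K j<K , toStep connected ,
      λ j<q sc → maximal (s≤s (subst (j <_) (length-π w len) j<q)) (fromStep sc)

    Good-up : Good (applyUpTo (extend w) (suc K′))
    Good-up = Good-applyUpTo (extend w) (suc K′) down-closed (λ j sj<K → Swap⇒AdjTransp (swap-next j sj<K))

    Good-down : Good (applyDownFrom (extend w) (suc K′))
    Good-down = Good-applyDownFrom (extend w) (suc K′) down-closed (λ j sj<K → Swap⇒AdjTransp (Swap-sym (swap-next j sj<K)))

    Chain-up : ∀ Y → Chain true (extend w K′ ∷ Y) → Chain true (applyUpTo (extend w) (suc K′) ++ Y)
    Chain-up Y chain = Chain-applyUpTo (λ j → odd? (suc j)) (extend w) K′ Y (λ j → refl)
      (λ j j<K′ → swap-next j (s≤s j<K′)) (subst (λ b → Chain b (extend w K′ ∷ Y)) (sym odd-K) chain)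

    Chain-down : ∀ Y → Chain false (extend w 0 ∷ Y) → Chain false (applyDownFrom (extend w) (suc K′) ++ Y)
    Chain-down Y chain = subst (λ b → Chain b (applyDownFrom (extend w) (suc K′) ++ Y)) (odd?-double n)
      (Chain-applyDownFrom odd? (extend w) K′ Y (λ j → refl) (λ j j<K′ → Swap-sym (swap-next j (s≤s j<K′))) chain)

  module Junctions (w w′ : List ℕ) (len : length w ≡ n) (len′ : length w′ ≡ n) where
    private
      module W  = Word w len
      module W′ = Word w′ len′

    swap-ends : ∀ {b} → Swap b (π w) (π w′) → SwapOfπ b (extend w K′) (extend w′ K′)
    swap-ends swapped = subst₂ (Swap _) (at-end w len) (at-end w′ len′) (swap-at-end n swapped)
      where
      at-end : ∀ v → length v ≡ n → step n (π v) (suc (length (π v))) ≡ π (extend v K′)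
      at-end v len = trans (cong (λ k → step n (π v) (suc k)) (length-π v len)) (sym (π-extend v len K′))

    swap-starts : ∀ {b} → Swap b (π w) (π w′) → SwapOfπ false (extend w 0) (extend w′ 0)
    swap-starts swapped = subst₂ (Swap false) (sym (π-extend w len 0)) (sym (π-extend w′ len′ 0)) (swap-at-front n swapped)

    junction-up : Swap true (π w) (π w′) → ∀ Y →
      Junction (applyUpTo (extend w) (suc K′)) (applyDownFrom (extend w′) (suc K′) ++ Y)
    junction-up swapped Y = Junction-applyUpTo (extend w) (suc K′) λ j j<K connected maximal →
      Next-++ (applyDownFrom (extend w′) (suc K′))
        (Next-applyDownFrom (extend w′) (suc K′) λ j′ j′<K connected′ maximal′ →
          subst₂ AdjTransp (sym (π-extend w len j)) (sym (π-extend w′ len′ j′))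
            (max-connected-swap n (-top∉π w len) (-top∉π w′ len′) swapped
              (W.max-connected j j<K connected maximal) (W′.max-connected j′ j′<K connected′ maximal′)))
        (λ none → ⊥-elim (NoneP-applyDownFrom (extend w′) K′ W′.first-connected none))

    -- From a descending block into an ascending one: both ends are connected.
    junction-down : ∀ {b} → Swap b (π w) (π w′) → ∀ Y →
      Junction (applyDownFrom (extend w) (suc K′)) (applyUpTo (extend w′) (suc K′) ++ Y)
    junction-down swapped Y = Junction-applyDownFrom (extend w) (suc K′) W.first-connected
      ((λ _ → Swap⇒AdjTransp (swap-starts swapped)) , λ ¬connected → ⊥-elim (¬connected W′.first-connected))

  Lengths : List (List ℕ) → Set
  Lengths = All (λ w → length w ≡ n)

  Chain-Blocks : ∀ b L → Lengths L → Chain b L → Chain b (Blocks b (suc K′) L)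
  Chain-Blocks b     []            _                         _               = tt
  Chain-Blocks true  (w ∷ [])      (len ∷ [])                _               = Word.Chain-up w len [] tt
  Chain-Blocks false (w ∷ [])      (len ∷ [])                _               = Word.Chain-down w len [] tt
  Chain-Blocks true  (w ∷ w′ ∷ ws) (len ∷ lens@(len′ ∷ _)) (swapped , chain) =
    Word.Chain-up w len _ (Junctions.swap-ends w w′ len len′ swapped , Chain-Blocks false (w′ ∷ ws) lens chain)
  Chain-Blocks false (w ∷ w′ ∷ ws) (len ∷ lens@(len′ ∷ _)) (swapped , chain) =
    Word.Chain-down w len _ (Junctions.swap-starts w w′ len len′ swapped , Chain-Blocks true (w′ ∷ ws) lens chain)

  Good-Blocks : ∀ b L → Lengths L → Chain b L → Good (Blocks b (suc K′) L)
  Good-Blocks b     []            _                         _               = tt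
  Good-Blocks true  (w ∷ [])      (len ∷ [])                _               =
    Good-++ (applyUpTo (extend w) (suc K′)) (Word.Good-up w len) tt (Junction-[] (applyUpTo (extend w) (suc K′)))
  Good-Blocks false (w ∷ [])      (len ∷ [])                _               =
    Good-++ (applyDownFrom (extend w) (suc K′)) (Word.Good-down w len) tt (Junction-[] (applyDownFrom (extend w) (suc K′)))
  Good-Blocks true  (w ∷ w′ ∷ ws) (len ∷ lens@(len′ ∷ _)) (swapped , chain) =
    Good-++ (applyUpTo (extend w) (suc K′)) (Word.Good-up w len) (Good-Blocks false (w′ ∷ ws) lens chain)
      (Junctions.junction-up w w′ len len′ swapped _)
  Good-Blocks false (w ∷ w′ ∷ ws) (len ∷ lens@(len′ ∷ _)) (swapped , chain) =
    Good-++ (applyDownFrom (extend w) (suc K′)) (Word.Good-down w len) (Good-Blocks true (w′ ∷ ws) lens chain)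
      (Junctions.junction-down w w′ len len′ swapped _)

lengths-G : ∀ n → All (λ w → length w ≡ n) (G n)
lengths-G n = All.tabulate (length-∈G n)

Chain-G : ∀ n → Chain true (G n)
Chain-G zero    = tt
Chain-G (suc n) = subst (Chain true) (sym (G-suc n)) (Level.Chain-Blocks n true (G n) (lengths-G n) (Chain-G n))

Good-G : ∀ n → Good (G (suc n))
Good-G n = subst Good (sym (G-suc n)) (Level.Good-Blocks n true (G n) (lengths-G n) (Chain-G n))

-- π is injective on G n: the position of n+1 in π w recovers the last letter
-- of w, and deleting n+1 and -(n+1) leaves π of the remaining word.
extend-injective : ∀ {w w′ i j} → extend w i ≡ extend w′ j → w ≡ w′ × i ≡ j
extend-injective {w} {w′} eq = ∷ʳ-injectiveˡ w w′ eq , suc-injective (∷ʳ-injectiveʳ w w′ eq)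

π-injective : ∀ n {w w′} → w ∈ G n → w′ ∈ G n → π w ≡ π w′ → w ≡ w′
π-injective zero    (here refl) (here refl) _ = refl
π-injective (suc n) w∈ w′∈ πw≡πw′
  with v , j , v∈ , j≤ , refl ← ∈-G-suc⁻ n w∈
  with v′ , j′ , v′∈ , j′≤ , refl ← ∈-G-suc⁻ n w′∈
  with refl , πv≡πv′ ← insertAt-injective j j′ (+ suc n) (π v) (π v′)
         (top∉π v (length-∈G n v∈)) (top∉π v′ (length-∈G n v′∈))
         (subst (j ≤_) (sym (length-π v (length-∈G n v∈))) j≤) (subst (j′ ≤_) (sym (length-π v′ (length-∈G n v′∈))) j′≤)
         (∷ʳ-injectiveˡ _ _ (trans (sym (π-extend v (length-∈G n v∈) j)) (trans πw≡πw′ (π-extend v′ (length-∈G n v′∈) j′))))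
  with refl ← π-injective n v∈ v′∈ πv≡πv′
  = refl

-- G n lists no word twice: blocks are duplicate-free and belong to distinct words.
block-disjoint : ∀ b K {w ws a} → Unique (w ∷ ws) → (∃ λ i → i < K × a ≡ extend w i) → a ∉ Blocks b K ws
block-disjoint b K {w} {ws} u (i , _ , refl) a∈ with ∈-Blocks⁻ b K ws a∈
... | v , j , v∈ , _ , eq = Unique.Unique[x∷xs]⇒x∉xs u (subst (_∈ ws) (sym (proj₁ (extend-injective eq))) v∈)

Unique-Blocks : ∀ b K L → Unique L → Unique (Blocks b K L)
Unique-Blocks b     K []       _                 = []
Unique-Blocks true  K (w ∷ ws) u@(_ ∷ uniqueWs) =
  Unique.++⁺ (Unique.applyUpTo⁺₁ (extend w) K (λ i<j _ eq → <⇒≢ i<j (proj₂ (extend-injective eq))))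
             (Unique-Blocks false K ws uniqueWs)
             (λ (a∈ , a∈ws) → block-disjoint false K u (SetoidMembership.∈-applyUpTo⁻ (setoid _) (extend w) a∈) a∈ws)
Unique-Blocks false K (w ∷ ws) u@(_ ∷ uniqueWs) =
  Unique.++⁺ (Unique.applyDownFrom⁺₁ (extend w) K (λ j<i _ eq → <⇒≢ j<i (sym (proj₂ (extend-injective eq)))))
             (Unique-Blocks true K ws uniqueWs)
             (λ (a∈ , a∈ws) → block-disjoint true K u (SetoidMembership.∈-applyDownFrom⁻ (setoid _) (extend w) a∈) a∈ws)

Unique-G : ∀ n → Unique (G n)
Unique-G zero    = [] ∷ []
Unique-G (suc n) = subst Unique (sym (G-suc n)) (Unique-Blocks true _ (G n) (Unique-G n))

-- The negative entries of a standard permutation end with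
-- -(n+1); its last entry is negative (a positive +k would need -k after it),
-- so it is -(n+1).  Deleting ±(n+1) gives a standard permutation of
-- {±1..±n}, which by induction is π v for some v in G n; reinserting n+1
-- at its position corresponds to appending a letter to v.
∈-range⁺ : ∀ {i n} → i < n → suc i ∈ range n
∈-range⁺ i<n = ∈-map⁺ suc (∈-upTo⁺ i<n)

∈-range⁻ : ∀ {i n} → i ∈ range n → ∃ λ i′ → i ≡ suc i′ × i′ < n
∈-range⁻ i∈ with i′ , i′∈ , i≡ ← ∈-map⁻ suc i∈ = i′ , i≡ , ∈-upTo⁻ i′∈

range-⊆ : ∀ {i} n → i ∈ range n → i ∈ range (suc n)
range-⊆ {i} n i∈ = subst (i ∈_) (sym (range-suc n)) (∈-++⁺ˡ i∈)

Before-dropLast : ∀ {y t a} X → Before y t (X ++ [ a ]) → t ≢ a → Before y t X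
Before-dropLast []      (here ())         _
Before-dropLast []      (there ())        _
Before-dropLast (x ∷ X) (here t∈)         t≢a with ∈-++⁻ X t∈
... | inj₁ t∈X        = here t∈X
... | inj₂ (here t≡a) = ⊥-elim (t≢a t≡a)
Before-dropLast (x ∷ X) (there before)    t≢a = there (Before-dropLast X before t≢a)

Before-delete : ∀ {y t a} X {Y} → Before y t (X ++ a ∷ Y) → a ≢ y → t ≢ a → Before y t (X ++ Y)
Before-delete []      (here _)       a≢y _   = ⊥-elim (a≢y refl)
Before-delete []      (there before) _   _   = before
Before-delete (x ∷ X) (here t∈)      _   t≢a with ∈-++⁻ X t∈
... | inj₁ t∈X          = here (∈-++⁺ˡ t∈X)
... | inj₂ (here t≡a)   = ⊥-elim (t≢a t≡a)
... | inj₂ (there t∈Y)  = here (∈-++⁺ʳ X t∈Y)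
Before-delete (x ∷ X) (there before) a≢y t≢a = there (Before-delete X before a≢y t≢a)

last-entry : ∀ n init t → StandardPerm (suc n) (init ++ [ t ]) → t ≡ -[1+ n ]
last-entry n init (+ k) (perm , order , _)
  with ∈signedList⇒InRange (suc n) (∈-resp-↭ perm (∈-++⁺ʳ init (here refl)))
... | i , i< , inj₁ refl
  with as , bs , eq , -k∈bs ← order (suc i) (∈-range⁺ i<)
  with refl ← nothing-after-last as init (Unique-↭ (↭-sym perm) (Unique-signedList (suc n))) (sym eq)
  = ⊥-elim (case-empty -k∈bs)
  where
  case-empty : - (+ suc i) ∉ []
  case-empty ()
last-entry n init -[1+ k ] (_ , _ , negs≡) =
  ∷ʳ-injectiveʳ (negs init) (negatives n) (trans (sym (negs-++ init [ -[1+ k ] ])) (trans negs≡ (negatives-suc n)))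

top∈signedList : ∀ n → + suc n ∈ signedList (suc n)
top∈signedList n = subst (+ suc n ∈_) (sym (signedList-suc n)) (∈-++⁺ʳ (signedList n) (here refl))

standard-form : ∀ n p → StandardPerm (suc n) p → ∃ λ xs → ∃ λ ys → p ≡ (xs ++ + suc n ∷ ys) ++ [ -[1+ n ] ]
standard-form n p sp@(perm , _) with initLast p | ∈-resp-↭ (↭-sym perm) (top∈signedList n)
... | []         | ()
... | init ∷ʳ′ t | top∈ with refl ← last-entry n init t sp with ∈-++⁻ init top∈
...   | inj₂ (here ())
...   | inj₁ top∈init with xs , ys , refl ← ∈-∃++ top∈init = xs , ys , refl

StandardPerm-delete : ∀ n xs ys → StandardPerm (suc n) ((xs ++ + suc n ∷ ys) ++ [ -[1+ n ] ]) → StandardPerm n (xs ++ ys)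
StandardPerm-delete n xs ys (perm , order , negs≡) = perm′ , order′ , negs′
  where
  z -z : ℤ
  z  = + suc n
  -z = -[1+ n ]
  front : (xs ++ z ∷ ys) ++ [ -z ] ↭ z ∷ -z ∷ xs ++ ys
  front = ↭-trans (++-comm (xs ++ z ∷ ys) [ -z ]) (↭-trans (prep -z (shift z xs ys)) (swap -z z ↭-refl))
  front′ : signedList (suc n) ↭ z ∷ -z ∷ signedList n
  front′ = subst (_↭ z ∷ -z ∷ signedList n) (sym (signedList-suc n)) (++-comm (signedList n) (z ∷ -z ∷ []))
  perm′ : xs ++ ys ↭ signedList n
  perm′ = drop-∷ (drop-∷ (↭-trans (↭-sym front) (↭-trans perm front′)))
  order′ : ∀ i → i ∈ range n → ∃ λ as → ∃ λ bs → (xs ++ ys ≡ as ++ (+ i) ∷ bs) × (- (+ i)) ∈ bs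
  order′ i i∈ with i′ , refl , i′<n ← ∈-range⁻ i∈ with as , bs , eq , -i∈ ← order (suc i′) (range-⊆ n i∈) =
    Before⇒split (Before-delete xs (Before-dropLast (xs ++ z ∷ ys) (subst (Before _ _) (sym eq) (split⇒Before as bs -i∈)) -i≢-z) z≢i -i≢z)
    where
    -i≢-z : -[1+ i′ ] ≢ -z
    -i≢-z refl = <-irrefl refl i′<n
    z≢i : z ≢ + suc i′
    z≢i refl = <-irrefl refl i′<n
    -i≢z : -[1+ i′ ] ≢ z
    -i≢z ()
  negs′ : negs (xs ++ ys) ≡ negatives n
  negs′ = ∷ʳ-injectiveˡ (negs (xs ++ ys)) (negatives n) (begin
    negs (xs ++ ys) ++ [ -z ]               ≡⟨ cong (_++ [ -z ]) (negs-++ xs ys) ⟩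
    (negs xs ++ negs (z ∷ ys)) ++ [ -z ]    ≡⟨ cong (_++ [ -z ]) (sym (negs-++ xs (z ∷ ys))) ⟩
    negs (xs ++ z ∷ ys) ++ [ -z ]           ≡⟨ sym (negs-++ (xs ++ z ∷ ys) [ -z ]) ⟩
    negs ((xs ++ z ∷ ys) ++ [ -z ])         ≡⟨ negs≡ ⟩
    negatives (suc n)                       ≡⟨ negatives-suc n ⟩
    negatives n ++ [ -z ]                   ∎)
    where open ≡-Reasoning

StandardPerm⇒∈G : ∀ n p → StandardPerm n p → ∃ λ w → w ∈ G n × π w ≡ p
StandardPerm⇒∈G zero    p (perm , _) = [] , here refl , sym (↭-empty-inv perm)
StandardPerm⇒∈G (suc n) p sp
  with xs , ys , refl ← standard-form n p sp
  with v , v∈ , πv≡ ← StandardPerm⇒∈G n (xs ++ ys) (StandardPerm-delete n xs ys sp)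
  = extend v (length xs) , ∈-G-suc⁺ n v∈ xs≤ , πw≡
  where
  xs≤ : length xs ≤ n + n
  xs≤ = subst (length xs ≤_) (trans (sym (length-++ xs)) (trans (cong length (sym πv≡)) (length-π v (length-∈G n v∈))))
          (m≤m+n (length xs) (length ys))
  πw≡ : π (extend v (length xs)) ≡ (xs ++ + suc n ∷ ys) ++ [ -[1+ n ] ]
  πw≡ = begin
    π (extend v (length xs))                                ≡⟨ π-extend v (length-∈G n v∈) (length xs) ⟩
    insertAt (length xs) (+ suc n) (π v) ++ [ -[1+ n ] ]     ≡⟨ cong (λ q → insertAt (length xs) (+ suc n) q ++ [ -[1+ n ] ]) πv≡ ⟩
    insertAt (length xs) (+ suc n) (xs ++ ys) ++ [ -[1+ n ] ] ≡⟨ cong (_++ [ -[1+ n ] ]) (insertAt-after (+ suc n) xs ys) ⟩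
    (xs ++ + suc n ∷ ys) ++ [ -[1+ n ] ]                     ∎
    where open ≡-Reasoning

theorem6p1 : (n : ℕ) → 1 ≤ n →
    ((i j : Fin (length (G n))) → toℕ i < toℕ j →
      ArcConnected (lookup (G n) i) → ArcConnected (lookup (G n) j) →
      ((k : Fin (length (G n))) → toℕ i < toℕ k → toℕ k < toℕ j →
        ¬ ArcConnected (lookup (G n) k)) →
      AdjTransp (π (lookup (G n) i)) (π (lookup (G n) j)))
    × ((w : List _) → w ∈ G n → StandardPerm n (π w))
    × ((p : List ℤ) → StandardPerm n p → SignConnected p →
      ∃ λ (i : Fin (length (G n))) → (π (lookup (G n) i) ≡ p) ×
        ((k : Fin (length (G n))) → π (lookup (G n) k) ≡ p → k ≡ i))
theorem6p1 (suc n) _ = Good-lookup (G (suc n)) (Good-G n) , standard , enumerated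
  where
  standard : (w : List ℕ) → w ∈ G (suc n) → StandardPerm (suc n) (π w)
  standard w w∈ = subst (λ k → StandardPerm k (π w)) (length-∈G (suc n) w∈) (StandardPerm-π w)
  enumerated : (p : List ℤ) → StandardPerm (suc n) p → SignConnected p →
    ∃ λ (i : Fin (length (G (suc n)))) → (π (lookup (G (suc n)) i) ≡ p) ×
      ((k : Fin (length (G (suc n)))) → π (lookup (G (suc n)) k) ≡ p → k ≡ i)
  enumerated p sp _ with w , w∈ , πw≡p ← StandardPerm⇒∈G (suc n) p sp =
    index w∈ , trans (cong π (sym (lookup-index w∈))) πw≡p ,
    λ k πk≡p → lookup-injective (Unique-G (suc n)) k (index w∈)
      (trans (π-injective (suc n) (∈-lookup k) w∈ (trans πk≡p (sym πw≡p))) (lookup-index w∈))
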